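{- Let $S\le T$ be subsets of $[n]$ in the type $C_n$ Gale order and let $\ell\in[n]$ not be a coloop of $\Delta[S,T]$. Let $A=S$ if $\ell\notin S$, and $A=(S\setminus\{\ell\})\cup\{\min\{i\notin S: \ell<i\}\}$ otherwise. Let $B=T$ if $\ell\notin T$, and $B=(T\setminus\{\ell\})\cup\{\max\{i\notin T: i<\ell\}\}$ otherwise, where if $\{i\in[n]\setminus T: i<\ell\}$ is empty then nothing is adjoined. Then the deletion $\Delta[S,T]\setminus\ell$ is the lattice path delta matroid $\Delta[A,B]$ on ground set $[n]\setminus\{\ell\}$ (with its induced order).
   Context: For a finite totally ordered set $E$, the type $C$ Gale order on subsets of $E$: $A=\{a_1<\dots<a_j\}\le B=\{b_1<\dots<b_k\}$ iff $j\le k$ and $a_{j-i+1}\le b_{k-i+1}$ for all $i\in[j]$; for $S\le T$, $\Delta[S,T]$ on $E$ is the delta matroid with feasible sets $\{R\subseteq E: S\le R\le T\}$. A coloop of a delta matroid is an element in every feasible set. The deletion $\Delta\setminus\ell$ has feasible sets $\{B \text{ feasible}: \ell\notin B\}$ on ground set $[n]\setminus\{\ell\}$. -}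

module Defs where

open import Data.Bool using (true; false)
open import Data.Nat using (ℕ)
open import Data.Fin using (Fin; zero; suc; _≤_; _<_; _<?_)
open import Data.Fin.Subset using (Subset; _∈_; _∉_; _∪_; _-_; ⁅_⁆)
open import Data.Fin.Subset.Properties using (_∈?_)
open import Data.List using (List; []; _∷_; map; reverse; filter; head; last; allFin)
open import Data.Vec as V using ()
open import Data.Maybe using (Maybe; just; nothing)
open import Data.Product using (_×_)
open import Data.Unit using (⊤)
open import Data.Empty using (⊥)
open import Relation.Nullary using (¬_)
open import Relation.Nullary.Decidable using (_×-dec_; ¬?)

-- Subsets of [n] are modelled as subsets of Fin n (order-isomorphic to [n]).

elemsAsc : ∀ {n} → Subset n → List (Fin n)
elemsAsc {ℕ.zero} _ = []
elemsAsc {ℕ.suc n} (V._∷_ true p) = zero ∷ map suc (elemsAsc p)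
elemsAsc {ℕ.suc n} (V._∷_ false p) = map suc (elemsAsc p)

elemsDesc : ∀ {n} → Subset n → List (Fin n)
elemsDesc p = reverse (elemsAsc p)

-- Given decreasing lists (a_j,...,a_1) and (b_k,...,b_1):
-- j ≤ k and a_{j-i+1} ≤ b_{k-i+1} for all i ∈ [j].
galeDesc : ∀ {n} → List (Fin n) → List (Fin n) → Set
galeDesc []       _        = ⊤
galeDesc (a ∷ as) []       = ⊥
galeDesc (a ∷ as) (b ∷ bs) = (a ≤ b) × galeDesc as bs

_≤G_ : ∀ {n} → Subset n → Subset n → Set
A ≤G B = galeDesc (elemsDesc A) (elemsDesc B)

Feasible : ∀ {n} → Subset n → Subset n → Subset n → Set
Feasible S T R = (S ≤G R) × (R ≤G T)

IsColoop : ∀ {n} → Subset n → Subset n → Fin n → Set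
IsColoop {n} S T ℓ = (R : Subset n) → Feasible S T R → ℓ ∈ R

minAbove : ∀ {n} → Subset n → Fin n → Maybe (Fin n)
minAbove {n} S ℓ = head (filter (λ i → ¬? (i ∈? S) ×-dec (ℓ <? i)) (allFin n))

maxBelow : ∀ {n} → Subset n → Fin n → Maybe (Fin n)
maxBelow {n} T ℓ = last (filter (λ i → ¬? (i ∈? T) ×-dec (i <? ℓ)) (allFin n))

swapOut : ∀ {n} → Subset n → Fin n → Maybe (Fin n) → Subset n
swapOut X ℓ (just m) = (X - ℓ) ∪ ⁅ m ⁆
swapOut X ℓ nothing  = X - ℓ

newA : ∀ {n} → Subset n → Fin n → Subset n
newA S ℓ with ℓ ∈? S
... | Relation.Nullary.yes _ = swapOut S ℓ (minAbove S ℓ)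
... | Relation.Nullary.no  _ = S

newB : ∀ {n} → Subset n → Fin n → Subset n
newB T ℓ with ℓ ∈? T
... | Relation.Nullary.yes _ = swapOut T ℓ (maxBelow T ℓ)
... | Relation.Nullary.no  _ = T

module Submission where

-- The type C Gale order X ≤ Y holds iff every final segment {k, …, n} contains at least as many
-- elements of Y as of X. Fix R with ℓ ∉ R. When ℓ ∈ S, the set A moves ℓ up to the first hole m
-- above it, raising the tail counts of S by one exactly on (ℓ, m]; if S ≤ R, then, as S contains
-- ℓ and all of (ℓ, m) while R avoids ℓ, the tail counts of R already exceed those of S there, so
-- S ≤ R ⇔ A ≤ R (and the hole m must exist). Symmetrically B moves ℓ down to the last
-- hole below it, lowering the tail counts of T by one exactly on the run of T ending at ℓ, where
-- R is already one short of T; so R ≤ T ⇔ R ≤ B. Since ℓ is not a coloop such an R exists, and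
-- then A ≤ R ≤ B.

open import Defs
open import Data.Bool using (Bool; true; false; not; _∨_)
open import Data.Bool.Properties using (∧-identityʳ)
open import Data.Fin using (Fin; zero; suc; _<_)
open import Data.Fin.Properties using (_<?_)
open import Data.Fin.Subset using (Subset; _∈_; _∉_; _∪_; _-_; ⁅_⁆; ∣_∣; inside; outside)
open import Data.Fin.Subset using () renaming (⊥ to ∅)
open import Data.Fin.Subset.Properties using (_∈?_; drop-there; ∣p∣≤n; ∪-identityʳ; p─⊥≡p; anySubset?)
open import Data.List using (List; []; _∷_; map; _++_; length; filter; head; last; allFin)
open import Data.List.Properties using (filter-reject; filter-none; map-tabulate; head-map; last-map; reverse-map; unfold-reverse; ++-identityʳ; length-reverse; length-map)
open import Data.List.Relation.Unary.All.Properties using (tabulate⁺)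
open import Data.Maybe as Maybe using (Maybe; just; nothing; fromMaybe; is-just)
open import Data.Nat as ℕ using (ℕ; z≤n; s≤s; s≤s⁻¹)
open import Data.Nat.Properties as ℕ using (≤-refl; ≤-trans; ≤-reflexive; n≤1+n)
open import Data.Product using (_×_; _,_; ∃-syntax; map₁; map₂)
open import Data.Product.Function.NonDependent.Propositional using (_×-⇔_)
open import Data.Unit using (⊤; tt)
open import Data.Vec using ([]; _∷_; here; there)
open import Function using (id; _∘_)
open import Function.Bundles using (_⇔_; mk⇔; Equivalence)
import Function.Properties.Equivalence as ⇔
open import Relation.Binary.PropositionalEquality
open import Relation.Nullary using (¬_; Dec; yes; no; does; contradiction)
open import Relation.Nullary.Decidable as Dec using (_×-dec_; ¬?; decidable-stable)
open import Relation.Unary using (Pred; Decidable)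
open import Level using (0ℓ)

private
  variable
    n : ℕ

_≤ᵗ_ : Subset n → Subset n → Set
[]      ≤ᵗ []      = ⊤
(x ∷ X) ≤ᵗ (y ∷ Y) = X ≤ᵗ Y × ∣ x ∷ X ∣ ℕ.≤ ∣ y ∷ Y ∣

≤ᵗ-refl : (X : Subset n) → X ≤ᵗ X
≤ᵗ-refl []      = tt
≤ᵗ-refl (x ∷ X) = ≤ᵗ-refl X , ≤-refl

≤ᵗ-trans : {X Y Z : Subset n} → X ≤ᵗ Y → Y ≤ᵗ Z → X ≤ᵗ Z
≤ᵗ-trans {X = []}    {[]}    {[]}    _       _       = tt
≤ᵗ-trans {X = _ ∷ _} {_ ∷ _} {_ ∷ _} (p , c) (q , d) = ≤ᵗ-trans p q , ≤-trans c d

≤ᵗ⇒∣p∣≤∣q∣ : {X Y : Subset n} → X ≤ᵗ Y → ∣ X ∣ ℕ.≤ ∣ Y ∣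
≤ᵗ⇒∣p∣≤∣q∣ {X = []}    {[]}    _       = z≤n
≤ᵗ⇒∣p∣≤∣q∣ {X = _ ∷ _} {_ ∷ _} (_ , c) = c

_≤ᵗ?_ : (X Y : Subset n) → Dec (X ≤ᵗ Y)
[]      ≤ᵗ? []      = yes tt
(x ∷ X) ≤ᵗ? (y ∷ Y) = (X ≤ᵗ? Y) ×-dec (∣ x ∷ X ∣ ℕ.≤? ∣ y ∷ Y ∣)

∣x∷p∣≤1+∣p∣ : ∀ x (p : Subset n) → ∣ x ∷ p ∣ ℕ.≤ ℕ.suc ∣ p ∣
∣x∷p∣≤1+∣p∣ inside  p = ≤-refl
∣x∷p∣≤1+∣p∣ outside p = n≤1+n ∣ p ∣

∣x∷p∣≤∣x∷q∣ : ∀ x (p q : Subset n) → ∣ p ∣ ℕ.≤ ∣ q ∣ → ∣ x ∷ p ∣ ℕ.≤ ∣ x ∷ q ∣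
∣x∷p∣≤∣x∷q∣ inside  _ _ = s≤s
∣x∷p∣≤∣x∷q∣ outside _ _ = id

suc∉⇒∉ : {x : Bool} {p : Subset n} {i : Fin n} → suc i ∉ x ∷ p → i ∉ p
suc∉⇒∉ i∉ i∈ = i∉ (there i∈)

∣p∣<n⇒∃∉ : {p : Subset n} → ∣ p ∣ ℕ.< n → ∃[ i ] i ∉ p
∣p∣<n⇒∃∉ {p = outside ∷ p} _        = zero , λ ()
∣p∣<n⇒∃∉ {p = inside  ∷ p} (s≤s lt) with i , i∉p ← ∣p∣<n⇒∃∉ lt = suc i , i∉p ∘ drop-there

zeroIf : Bool → List (Fin (ℕ.suc n))
zeroIf inside  = zero ∷ []
zeroIf outside = []

elemsDesc-∷ : ∀ x (X : Subset n) → elemsDesc (x ∷ X) ≡ map suc (elemsDesc X) ++ zeroIf x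
elemsDesc-∷ inside  X = trans (unfold-reverse zero (map suc (elemsAsc X)))
                              (cong (_++ zeroIf inside) (sym (reverse-map suc (elemsAsc X))))
elemsDesc-∷ outside X = trans (sym (reverse-map suc (elemsAsc X))) (sym (++-identityʳ _))

length-elemsDesc : (X : Subset n) → length (elemsDesc X) ≡ ∣ X ∣
length-elemsDesc X = trans (length-reverse (elemsAsc X)) (length-elemsAsc X)
  where
  length-elemsAsc : ∀ {n} (X : Subset n) → length (elemsAsc X) ≡ ∣ X ∣
  length-elemsAsc []            = refl
  length-elemsAsc (inside  ∷ X) = cong ℕ.suc (trans (length-map suc (elemsAsc X)) (length-elemsAsc X))
  length-elemsAsc (outside ∷ X) = trans (length-map suc (elemsAsc X)) (length-elemsAsc X)

galeDesc-suc⁺ : ∀ (xs ys : List (Fin n)) x y → galeDesc xs ys →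
  length (map suc xs ++ zeroIf x) ℕ.≤ length (map suc ys ++ zeroIf y) →
  galeDesc (map suc xs ++ zeroIf x) (map suc ys ++ zeroIf y)
galeDesc-suc⁺ []       ys       outside y       _       _         = tt
galeDesc-suc⁺ []       []       inside  inside  _       _         = z≤n , tt
galeDesc-suc⁺ []       (_ ∷ _)  inside  y       _       _         = z≤n , tt
galeDesc-suc⁺ (_ ∷ xs) (_ ∷ ys) x       y       (a , g) (s≤s len) = s≤s a , galeDesc-suc⁺ xs ys x y g len

galeDesc-suc⁻ : ∀ (xs ys : List (Fin n)) x y → galeDesc (map suc xs ++ zeroIf x) (map suc ys ++ zeroIf y) →
  galeDesc xs ys × length (map suc xs ++ zeroIf x) ℕ.≤ length (map suc ys ++ zeroIf y)
galeDesc-suc⁻ []       ys       outside y       _       = tt , z≤n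
galeDesc-suc⁻ []       []       inside  inside  _       = tt , ≤-refl
galeDesc-suc⁻ []       (_ ∷ ys) inside  y       _       = tt , s≤s z≤n
galeDesc-suc⁻ (_ ∷ xs) []       x       inside  (() , _)
galeDesc-suc⁻ (_ ∷ xs) (_ ∷ ys) x       y       (s≤s a , g) = map₁ (a ,_) (map₂ s≤s (galeDesc-suc⁻ xs ys x y g))

≤G-∷⇔ : ∀ x (X : Subset n) y Y → (x ∷ X) ≤G (y ∷ Y) ⇔ (X ≤G Y × ∣ x ∷ X ∣ ℕ.≤ ∣ y ∷ Y ∣)
≤G-∷⇔ x X y Y
  rewrite sym (length-elemsDesc (x ∷ X)) | sym (length-elemsDesc (y ∷ Y))
        | elemsDesc-∷ x X | elemsDesc-∷ y Y
  = mk⇔ (galeDesc-suc⁻ (elemsDesc X) (elemsDesc Y) x y)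
        (λ (g , len) → galeDesc-suc⁺ (elemsDesc X) (elemsDesc Y) x y g len)

≤G⇔≤ᵗ : (X Y : Subset n) → X ≤G Y ⇔ X ≤ᵗ Y
≤G⇔≤ᵗ []      []      = mk⇔ _ _
≤G⇔≤ᵗ (x ∷ X) (y ∷ Y) = ⇔.trans (≤G-∷⇔ x X y Y) (≤G⇔≤ᵗ X Y ×-⇔ ⇔.refl)

fill : Subset n → Subset n
fill []            = []
fill (outside ∷ X) = inside ∷ X
fill (inside  ∷ X) = inside ∷ fill X

∣fill∣≤1+∣p∣ : (X : Subset n) → ∣ fill X ∣ ℕ.≤ ℕ.suc ∣ X ∣
∣fill∣≤1+∣p∣ []            = z≤n
∣fill∣≤1+∣p∣ (outside ∷ X) = ≤-refl
∣fill∣≤1+∣p∣ (inside  ∷ X) = s≤s (∣fill∣≤1+∣p∣ X)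

∉⇒∣p∣<∣fill∣ : (X : Subset n) {i : Fin n} → i ∉ X → ∣ X ∣ ℕ.< ∣ fill X ∣
∉⇒∣p∣<∣fill∣ (outside ∷ X)         _   = ≤-refl
∉⇒∣p∣<∣fill∣ (inside  ∷ X) {zero}  i∉X = contradiction here i∉X
∉⇒∣p∣<∣fill∣ (inside  ∷ X) {suc i} i∉X = s≤s (∉⇒∣p∣<∣fill∣ X (suc∉⇒∉ i∉X))

≤ᵗ-fill : (X : Subset n) → X ≤ᵗ fill X
≤ᵗ-fill []            = tt
≤ᵗ-fill (outside ∷ X) = ≤ᵗ-refl X , n≤1+n ∣ X ∣
≤ᵗ-fill (inside  ∷ X) = ≤ᵗ-fill X , s≤s (≤ᵗ⇒∣p∣≤∣q∣ (≤ᵗ-fill X))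

fill-≤ᵗ : {X Y : Subset n} → X ≤ᵗ Y → ∣ X ∣ ℕ.< ∣ Y ∣ → fill X ≤ᵗ Y
fill-≤ᵗ {X = outside ∷ X} {y ∷ Y} (X≤Y , _) lt = X≤Y , lt
fill-≤ᵗ {X = inside  ∷ X} {y ∷ Y} (X≤Y , _) lt =
  fill-≤ᵗ X≤Y (s≤s⁻¹ (≤-trans lt (∣x∷p∣≤1+∣p∣ y Y))) , ≤-trans (s≤s (∣fill∣≤1+∣p∣ X)) lt

-- When ℓ lies in the set, raise and lower compute the paper's A and B (swapOut-minAbove, swapOut-maxBelow).
raise : Subset n → Fin n → Subset n
raise (_ ∷ X) zero    = outside ∷ fill X
raise (x ∷ X) (suc ℓ) = x ∷ raise X ℓ

∉-raise : (X : Subset n) (ℓ : Fin n) → ℓ ∉ raise X ℓ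
∉-raise (_ ∷ X) zero    ()
∉-raise (_ ∷ X) (suc ℓ) ℓ∈ = ∉-raise X ℓ (drop-there ℓ∈)

∣raise∣≤∣p∣ : {X : Subset n} {ℓ : Fin n} → ℓ ∈ X → ∣ raise X ℓ ∣ ℕ.≤ ∣ X ∣
∣raise∣≤∣p∣ {X = _ ∷ X} here        = ∣fill∣≤1+∣p∣ X
∣raise∣≤∣p∣ {X = x ∷ X} (there ℓ∈X) = ∣x∷p∣≤∣x∷q∣ x (raise X _) X (∣raise∣≤∣p∣ ℓ∈X)

hole-above : {S R : Subset n} {ℓ : Fin n} → ℓ ∈ S → ℓ ∉ R → S ≤ᵗ R → ∃[ i ] (i ∉ S × ℓ < i)
hole-above {R = inside  ∷ R} here ℓ∉R _ = contradiction here ℓ∉R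
hole-above {R = outside ∷ R} here _ (_ , lt)
  with i , i∉S ← ∣p∣<n⇒∃∉ (≤-trans lt (∣p∣≤n R)) = suc i , i∉S ∘ drop-there , s≤s z≤n
hole-above {S = _ ∷ S} {_ ∷ R} (there ℓ∈S) ℓ∉R (S≤R , _)
  with i , i∉S , ℓ<i ← hole-above ℓ∈S (suc∉⇒∉ ℓ∉R) S≤R = suc i , i∉S ∘ drop-there , s≤s ℓ<i

raise-≤ᵗ : {S R : Subset n} {ℓ : Fin n} → ℓ ∈ S → ℓ ∉ R → S ≤ᵗ R → raise S ℓ ≤ᵗ R
raise-≤ᵗ {R = inside  ∷ R} here ℓ∉R _        = contradiction here ℓ∉R
raise-≤ᵗ {R = outside ∷ R} here _   (S≤R , lt) = fill-≤ᵗ S≤R lt , ≤ᵗ⇒∣p∣≤∣q∣ (fill-≤ᵗ S≤R lt)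
raise-≤ᵗ {S = s ∷ S} {_ ∷ R} (there ℓ∈S) ℓ∉R (S≤R , c) =
  raise-≤ᵗ ℓ∈S (suc∉⇒∉ ℓ∉R) S≤R , ≤-trans (∣x∷p∣≤∣x∷q∣ s (raise S _) S (∣raise∣≤∣p∣ ℓ∈S)) c

≤ᵗ-raise : {S : Subset n} {ℓ : Fin n} → ℓ ∈ S → ∃[ i ] (i ∉ S × ℓ < i) → S ≤ᵗ raise S ℓ
≤ᵗ-raise {S = _ ∷ S} here (suc i , i∉S , _) = ≤ᵗ-fill S , ∉⇒∣p∣<∣fill∣ S (suc∉⇒∉ i∉S)
≤ᵗ-raise {S = s ∷ S} (there ℓ∈S) (suc i , i∉S , s≤s ℓ<i) =
  S≤raise , ∣x∷p∣≤∣x∷q∣ s S (raise S _) (≤ᵗ⇒∣p∣≤∣q∣ S≤raise)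
  where S≤raise = ≤ᵗ-raise ℓ∈S (i , suc∉⇒∉ i∉S , ℓ<i)

holeBelow : Subset n → Fin n → Bool
holeBelow (_ ∷ _) zero    = false
holeBelow (x ∷ X) (suc ℓ) = not x ∨ holeBelow X ℓ

-- A hole is filled exactly when no further hole lies between it and ℓ.
lower : Subset n → Fin n → Subset n
lower (_       ∷ X) zero    = outside ∷ X
lower (inside  ∷ X) (suc ℓ) = inside ∷ lower X ℓ
lower (outside ∷ X) (suc ℓ) = not (holeBelow X ℓ) ∷ lower X ℓ

∉-lower : (X : Subset n) (ℓ : Fin n) → ℓ ∉ lower X ℓ
∉-lower (_       ∷ X) zero    ()
∉-lower (inside  ∷ X) (suc ℓ) ℓ∈ = ∉-lower X ℓ (drop-there ℓ∈)
∉-lower (outside ∷ X) (suc ℓ) ℓ∈ = ∉-lower X ℓ (drop-there ℓ∈)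

-- Deleting ℓ costs one element, recovered exactly when a hole below ℓ is filled.
∣lower∣≡∣p∣ : {T : Subset n} {ℓ : Fin n} → ℓ ∈ T → ∣ not (holeBelow T ℓ) ∷ lower T ℓ ∣ ≡ ∣ T ∣
∣lower∣≡∣p∣ here = refl
∣lower∣≡∣p∣ {T = inside ∷ T} {suc ℓ} (there ℓ∈T) with holeBelow T ℓ | ∣lower∣≡∣p∣ ℓ∈T
... | true  | eq = cong ℕ.suc eq
... | false | eq = cong ℕ.suc eq
∣lower∣≡∣p∣ {T = outside ∷ T} (there ℓ∈T) = ∣lower∣≡∣p∣ ℓ∈T

lower-≤ᵗ : {T : Subset n} {ℓ : Fin n} → ℓ ∈ T → lower T ℓ ≤ᵗ T
lower-≤ᵗ {T = _ ∷ T} here = ≤ᵗ-refl T , n≤1+n ∣ T ∣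
lower-≤ᵗ {T = inside ∷ T} (there ℓ∈T) = lower-≤ᵗ ℓ∈T , s≤s (≤ᵗ⇒∣p∣≤∣q∣ (lower-≤ᵗ ℓ∈T))
lower-≤ᵗ {T = outside ∷ T} (there ℓ∈T) = lower-≤ᵗ ℓ∈T , ≤-reflexive (∣lower∣≡∣p∣ ℓ∈T)

≤ᵗ-lower : {T R : Subset n} {ℓ : Fin n} → ℓ ∈ T → ℓ ∉ R → R ≤ᵗ T → R ≤ᵗ lower T ℓ
≤ᵗ-lower {R = inside  ∷ R} here ℓ∉R _         = contradiction here ℓ∉R
≤ᵗ-lower {R = outside ∷ R} here _   (R≤T , _) = R≤T , ≤ᵗ⇒∣p∣≤∣q∣ R≤T
≤ᵗ-lower {T = inside ∷ T} {r ∷ R} (there ℓ∈T) ℓ∉R (R≤T , _) =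
  R≤lower , ≤-trans (∣x∷p∣≤1+∣p∣ r R) (s≤s (≤ᵗ⇒∣p∣≤∣q∣ R≤lower))
  where R≤lower = ≤ᵗ-lower ℓ∈T (suc∉⇒∉ ℓ∉R) R≤T
≤ᵗ-lower {T = outside ∷ T} {r ∷ R} (there ℓ∈T) ℓ∉R (R≤T , c) =
  ≤ᵗ-lower ℓ∈T (suc∉⇒∉ ℓ∉R) R≤T , ≤-trans c (≤-reflexive (sym (∣lower∣≡∣p∣ ℓ∈T)))

allFin-suc : ∀ n → allFin (ℕ.suc n) ≡ zero ∷ map suc (allFin n)
allFin-suc n = cong (zero ∷_) (sym (map-tabulate id suc))

filter-map-comm : {A B : Set} {P : Pred A 0ℓ} {Q : Pred B 0ℓ} (P? : Decidable P) (Q? : Decidable Q) (f : B → A) →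
  (∀ x → does (P? (f x)) ≡ does (Q? x)) → ∀ xs → filter P? (map f xs) ≡ map f (filter Q? xs)
filter-map-comm P? Q? f P∘f≡Q []       = refl
filter-map-comm P? Q? f P∘f≡Q (x ∷ xs) with does (P? (f x)) | does (Q? x) | P∘f≡Q x
... | true  | true  | refl = cong (f x ∷_) (filter-map-comm P? Q? f P∘f≡Q xs)
... | false | false | refl = filter-map-comm P? Q? f P∘f≡Q xs

last-∷ : {A : Set} (x : A) (xs : List A) → last (x ∷ xs) ≡ just (fromMaybe x (last xs))
last-∷ x []       = refl
last-∷ x (y ∷ ys) = trans (last-∷ y ys) (cong (just ∘ fromMaybe x) (sym (last-∷ y ys)))

filter-allFin-suc : {P : Pred (Fin (ℕ.suc n)) 0ℓ} {Q : Pred (Fin n) 0ℓ} (P? : Decidable P) (Q? : Decidable Q) →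
  ¬ P zero → (∀ i → does (P? (suc i)) ≡ does (Q? i)) →
  filter P? (allFin (ℕ.suc n)) ≡ map suc (filter Q? (allFin n))
filter-allFin-suc {n} P? Q? ¬P0 P∘suc≡Q = begin
  filter P? (allFin (ℕ.suc n))         ≡⟨ cong (filter P?) (allFin-suc n) ⟩
  filter P? (zero ∷ map suc (allFin n)) ≡⟨ filter-reject P? ¬P0 ⟩
  filter P? (map suc (allFin n))        ≡⟨ filter-map-comm P? Q? suc P∘suc≡Q (allFin n) ⟩
  map suc (filter Q? (allFin n))        ∎
  where open ≡-Reasoning

_∉?_ : (i : Fin n) (S : Subset n) → Dec (i ∉ S)
i ∉? S = ¬? (i ∈? S)

firstHole : Subset n → Maybe (Fin n)
firstHole {n} S = head (filter (_∉? S) (allFin n))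

firstHole-outside : (S : Subset n) → firstHole (outside ∷ S) ≡ just zero
firstHole-outside {n} S = cong (head ∘ filter (_∉? (outside ∷ S))) (allFin-suc n)

firstHole-inside : (S : Subset n) → firstHole (inside ∷ S) ≡ Maybe.map suc (firstHole S)
firstHole-inside S =
  trans (cong head (filter-allFin-suc (_∉? (inside ∷ S)) (_∉? S) (λ 0∉ → 0∉ here) (λ _ → refl)))
        (head-map {f = suc} _)

minAbove-zero : ∀ x (S : Subset n) → minAbove (x ∷ S) zero ≡ Maybe.map suc (firstHole S)
minAbove-zero {n} x S =
  trans (cong head (filter-allFin-suc above? (_∉? S) (λ ()) (λ i → ∧-identityʳ (does (i ∉? S)))))
        (head-map {f = suc} _)
  where above? = λ i → i ∉? (x ∷ S) ×-dec (zero {n} <? i)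

minAbove-suc : ∀ x (S : Subset n) (ℓ : Fin n) → minAbove (x ∷ S) (suc ℓ) ≡ Maybe.map suc (minAbove S ℓ)
minAbove-suc x S ℓ =
  trans (cong head (filter-allFin-suc above? aboveₛ? (λ ()) (λ _ → refl))) (head-map {f = suc} _)
  where
  above?  = λ i → i ∉? (x ∷ S) ×-dec (suc ℓ <? i)
  aboveₛ? = λ i → i ∉? S ×-dec (ℓ <? i)

maxBelow-zero : ∀ x (T : Subset n) → maxBelow (x ∷ T) zero ≡ nothing
maxBelow-zero {n} x T = cong last (filter-none below? {allFin (ℕ.suc n)} (tabulate⁺ {f = id} λ _ ()))
  where below? = λ i → i ∉? (x ∷ T) ×-dec (i <? zero {n})

maxBelow-inside : (T : Subset n) (ℓ : Fin n) → maxBelow (inside ∷ T) (suc ℓ) ≡ Maybe.map suc (maxBelow T ℓ)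
maxBelow-inside {n} T ℓ =
  trans (cong last (filter-allFin-suc below? belowₜ? (λ (0∉ , _) → 0∉ here) (λ _ → refl)))
        (last-map suc (filter belowₜ? (allFin n)))
  where
  below?  = λ i → i ∉? (inside ∷ T) ×-dec (i <? suc ℓ)
  belowₜ? = λ i → i ∉? T ×-dec (i <? ℓ)

maxBelow-outside : (T : Subset n) (ℓ : Fin n) →
  maxBelow (outside ∷ T) (suc ℓ) ≡ just (fromMaybe zero (Maybe.map suc (maxBelow T ℓ)))
maxBelow-outside {n} T ℓ = begin
  last (filter below? (allFin (ℕ.suc n)))            ≡⟨ cong (last ∘ filter below?) (allFin-suc n) ⟩
  last (zero ∷ filter below? (map suc (allFin n)))   ≡⟨ cong (last ∘ (zero ∷_)) (filter-map-comm below? belowₜ? suc (λ _ → refl) (allFin n)) ⟩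
  last (zero ∷ map suc holesₜ)                        ≡⟨ last-∷ zero (map suc holesₜ) ⟩
  just (fromMaybe zero (last (map suc holesₜ)))       ≡⟨ cong (just ∘ fromMaybe zero) (last-map suc holesₜ) ⟩
  just (fromMaybe zero (Maybe.map suc (last holesₜ))) ∎
  where
  open ≡-Reasoning
  below?  = λ i → i ∉? (outside ∷ T) ×-dec (i <? suc ℓ)
  belowₜ? = λ i → i ∉? T ×-dec (i <? ℓ)
  holesₜ  = filter belowₜ? (allFin n)

holeBelow≡is-just-maxBelow : (T : Subset n) (ℓ : Fin n) → holeBelow T ℓ ≡ is-just (maxBelow T ℓ)
holeBelow≡is-just-maxBelow (x ∷ T) zero rewrite maxBelow-zero x T = refl
holeBelow≡is-just-maxBelow (outside ∷ T) (suc ℓ) rewrite maxBelow-outside T ℓ = refl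
holeBelow≡is-just-maxBelow (inside  ∷ T) (suc ℓ) rewrite maxBelow-inside T ℓ
  with maxBelow T ℓ | holeBelow≡is-just-maxBelow T ℓ
... | just _  | eq = eq
... | nothing | eq = eq

adjoin : Subset n → Maybe (Fin n) → Subset n
adjoin X (just m) = X ∪ ⁅ m ⁆
adjoin X nothing  = X

adjoin-map-suc : ∀ x (X : Subset n) (m : Maybe (Fin n)) → adjoin (x ∷ X) (Maybe.map suc m) ≡ x ∷ adjoin X m
adjoin-map-suc inside  X (just m) = refl
adjoin-map-suc outside X (just m) = refl
adjoin-map-suc x       X nothing  = refl

adjoin-firstHole : (S : Subset n) → adjoin S (firstHole S) ≡ fill S
adjoin-firstHole []            = refl
adjoin-firstHole (outside ∷ S) rewrite firstHole-outside S = cong (inside ∷_) (∪-identityʳ S)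
adjoin-firstHole (inside  ∷ S) rewrite firstHole-inside S =
  trans (adjoin-map-suc inside S (firstHole S)) (cong (inside ∷_) (adjoin-firstHole S))

swapOut-zero : ∀ x (X : Subset n) (m : Maybe (Fin n)) → swapOut (x ∷ X) zero (Maybe.map suc m) ≡ outside ∷ adjoin X m
swapOut-zero x X (just m) = cong (λ Y → outside ∷ (Y ∪ ⁅ m ⁆)) (p─⊥≡p X)
swapOut-zero x X nothing  = cong (outside ∷_) (p─⊥≡p X)

swapOut-suc : ∀ x (X : Subset n) (ℓ : Fin n) (m : Maybe (Fin n)) → swapOut (x ∷ X) (suc ℓ) (Maybe.map suc m) ≡ x ∷ swapOut X ℓ m
swapOut-suc inside  X ℓ (just m) = refl
swapOut-suc outside X ℓ (just m) = refl
swapOut-suc x       X ℓ nothing  = refl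

swapOut-minAbove : (S : Subset n) (ℓ : Fin n) → swapOut S ℓ (minAbove S ℓ) ≡ raise S ℓ
swapOut-minAbove (x ∷ S) zero rewrite minAbove-zero x S =
  trans (swapOut-zero x S (firstHole S)) (cong (outside ∷_) (adjoin-firstHole S))
swapOut-minAbove (x ∷ S) (suc ℓ) rewrite minAbove-suc x S ℓ =
  trans (swapOut-suc x S ℓ (minAbove S ℓ)) (cong (x ∷_) (swapOut-minAbove S ℓ))

swapOut-maxBelow : (T : Subset n) (ℓ : Fin n) → swapOut T ℓ (maxBelow T ℓ) ≡ lower T ℓ
swapOut-maxBelow (x ∷ T) zero rewrite maxBelow-zero x T = cong (outside ∷_) (p─⊥≡p T)
swapOut-maxBelow (inside ∷ T) (suc ℓ) rewrite maxBelow-inside T ℓ =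
  trans (swapOut-suc inside T ℓ (maxBelow T ℓ)) (cong (inside ∷_) (swapOut-maxBelow T ℓ))
swapOut-maxBelow (outside ∷ T) (suc ℓ) rewrite maxBelow-outside T ℓ | holeBelow≡is-just-maxBelow T ℓ
  with maxBelow T ℓ | swapOut-maxBelow T ℓ
... | just _  | eq = cong (outside ∷_) eq
... | nothing | eq = cong (inside ∷_) (trans (∪-identityʳ (T - ℓ)) eq)

∉-newA : (S : Subset n) (ℓ : Fin n) → ℓ ∉ newA S ℓ
∉-newA S ℓ with ℓ ∈? S
... | yes _   rewrite swapOut-minAbove S ℓ = ∉-raise S ℓ
... | no  ℓ∉S = ℓ∉S

newA-≤ᵗ : {S R : Subset n} {ℓ : Fin n} → ℓ ∉ R → S ≤ᵗ R → newA S ℓ ≤ᵗ R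
newA-≤ᵗ {S = S} {ℓ = ℓ} ℓ∉R S≤R with ℓ ∈? S
... | yes ℓ∈S rewrite swapOut-minAbove S ℓ = raise-≤ᵗ ℓ∈S ℓ∉R S≤R
... | no  _   = S≤R

≤ᵗ-newA : {S : Subset n} {ℓ : Fin n} → (ℓ ∈ S → ∃[ i ] (i ∉ S × ℓ < i)) → S ≤ᵗ newA S ℓ
≤ᵗ-newA {S = S} {ℓ} hole with ℓ ∈? S
... | yes ℓ∈S rewrite swapOut-minAbove S ℓ = ≤ᵗ-raise ℓ∈S (hole ℓ∈S)
... | no  _   = ≤ᵗ-refl S

∉-newB : (T : Subset n) (ℓ : Fin n) → ℓ ∉ newB T ℓ
∉-newB T ℓ with ℓ ∈? T
... | yes _   rewrite swapOut-maxBelow T ℓ = ∉-lower T ℓ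
... | no  ℓ∉T = ℓ∉T

≤ᵗ-newB : {T R : Subset n} {ℓ : Fin n} → ℓ ∉ R → R ≤ᵗ T → R ≤ᵗ newB T ℓ
≤ᵗ-newB {T = T} {ℓ = ℓ} ℓ∉R R≤T with ℓ ∈? T
... | yes ℓ∈T rewrite swapOut-maxBelow T ℓ = ≤ᵗ-lower ℓ∈T ℓ∉R R≤T
... | no  _   = R≤T

newB-≤ᵗ : (T : Subset n) (ℓ : Fin n) → newB T ℓ ≤ᵗ T
newB-≤ᵗ T ℓ with ℓ ∈? T
... | yes ℓ∈T rewrite swapOut-maxBelow T ℓ = lower-≤ᵗ ℓ∈T
... | no  _   = ≤ᵗ-refl T

≤G⇒≤ᵗ : {X Y : Subset n} → X ≤G Y → X ≤ᵗ Y
≤G⇒≤ᵗ = Equivalence.to (≤G⇔≤ᵗ _ _)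

≤ᵗ⇒≤G : {X Y : Subset n} → X ≤ᵗ Y → X ≤G Y
≤ᵗ⇒≤G = Equivalence.from (≤G⇔≤ᵗ _ _)

_≤G?_ : (X Y : Subset n) → Dec (X ≤G Y)
X ≤G? Y = Dec.map (⇔.sym (≤G⇔≤ᵗ X Y)) (X ≤ᵗ? Y)

-- Feasibility is decidable, so ¬ IsColoop yields a witness constructively.
¬IsColoop⇒∃Feasible∌ : {S T : Subset n} {ℓ : Fin n} → ¬ IsColoop S T ℓ → ∃[ R ] (ℓ ∉ R × Feasible S T R)
¬IsColoop⇒∃Feasible∌ {S = S} {T} {ℓ} ¬coloop =
  decidable-stable (anySubset? λ R → ¬? (ℓ ∈? R) ×-dec ((S ≤G? R) ×-dec (R ≤G? T)))
    λ ∄R → ¬coloop λ R feasible → decidable-stable (ℓ ∈? R) λ ℓ∉R → ∄R (R , ℓ∉R , feasible)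

Feasible-deletion : {S T R : Subset n} {ℓ : Fin n} → (ℓ ∈ S → ∃[ i ] (i ∉ S × ℓ < i)) → ℓ ∉ R →
  Feasible S T R ⇔ Feasible (newA S ℓ) (newB T ℓ) R
Feasible-deletion {T = T} {ℓ = ℓ} hole ℓ∉R = mk⇔
  (λ (S≤R , R≤T) → ≤ᵗ⇒≤G (newA-≤ᵗ ℓ∉R (≤G⇒≤ᵗ S≤R)) , ≤ᵗ⇒≤G (≤ᵗ-newB ℓ∉R (≤G⇒≤ᵗ R≤T)))
  (λ (A≤R , R≤B) → ≤ᵗ⇒≤G (≤ᵗ-trans (≤ᵗ-newA hole) (≤G⇒≤ᵗ A≤R)) , ≤ᵗ⇒≤G (≤ᵗ-trans (≤G⇒≤ᵗ R≤B) (newB-≤ᵗ T ℓ)))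

proposition3p4 : (n : ℕ) (S T : Subset n) (ℓ : Fin n) →
    S ≤G T → ¬ IsColoop S T ℓ →
    (ℓ ∈ S → ∃[ i ] (i ∉ S × ℓ < i)) ×
    ℓ ∉ newA S ℓ × ℓ ∉ newB T ℓ × newA S ℓ ≤G newB T ℓ ×
    ((R : Subset n) → ℓ ∉ R →
      ((Feasible S T R) ⇔ (Feasible (newA S ℓ) (newB T ℓ) R)))
proposition3p4 n S T ℓ _ ¬coloop
  with R₀ , ℓ∉R₀ , S≤R₀ , R₀≤T ← ¬IsColoop⇒∃Feasible∌ ¬coloop =
  hole , ∉-newA S ℓ , ∉-newB T ℓ , A≤B , λ R ℓ∉R → Feasible-deletion hole ℓ∉R
  where
  hole : ℓ ∈ S → ∃[ i ] (i ∉ S × ℓ < i)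
  hole ℓ∈S = hole-above ℓ∈S ℓ∉R₀ (≤G⇒≤ᵗ S≤R₀)
  A≤B : newA S ℓ ≤G newB T ℓ
  A≤B = ≤ᵗ⇒≤G (≤ᵗ-trans (newA-≤ᵗ ℓ∉R₀ (≤G⇒≤ᵗ S≤R₀)) (≤ᵗ-newB ℓ∉R₀ (≤G⇒≤ᵗ R₀≤T)))
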